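{- Let $r,n,k$ be positive integers with $n\ge r+2$ and $k\le\lfloor (r-1)/2\rfloor$. Let $\widehat{\mathcal M}$ be a uniform $k$-neighborly oriented matroid of rank $r$ on the ground set $[n]$, let $\mathcal M:=\widehat{\mathcal M}|_{[n-1]}$, and let $\sigma:\mathcal C^*(\mathcal M)\to\{+,-\}$ be the localization of the single element extension from $\mathcal M$ to $\widehat{\mathcal M}$. Then for every $m\in\{1,\dots,k\}$ and every $(i_1,\dots,i_m)$ with $1\le i_1<\dots<i_m\le n$, the following holds: either $\sigma(C_j)=+$ for some $j\in\{1,\dots,p\}$, or else both [$\sigma(D_j)=+$ for some $j\in\{1,\dots,q\}$] and [$\sigma(D_j)=-$ for some $j\in\{1,\dots,q\}$]. Here $C_1,\dots,C_p$ are the non-negative cocircuits $C$ of $\mathcal M$ with $Z(C)\supseteq\{i_1,\dots,i_m\}$, and $D_1,\dots,D_q$ are the non-negative cocircuits $D$ of $\mathcal M$ with $|Z(D)\cap\{i_1,\dots,i_m\}|=m-1$.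
   Context: Oriented matroids are given by their covectors: sign vectors $X\in\{+,-,0\}^E$; $X^0$, $X^+$, $X^-$ are the sets where $X$ is $0$, $+$, $-$, and $Z(X):=X^0$. Cocircuits are the minimal nonzero covectors; $\mathcal C^*(\mathcal M)$ denotes the set of cocircuits. A covector is non-negative if $X^-=\emptyset$. An oriented matroid is uniform if its underlying matroid is uniform. The restriction $\mathcal M|_F$ has covectors $\{X|_F\}$. An oriented matroid $\mathcal M$ on $E$ is acyclic if the all-positive sign vector is a covector; a set $F\subseteq E$ is a face if there is a covector $X$ with $X^0=F$ and $X^+=E\setminus F$; $\mathcal M$ is $k$-neighborly if it is acyclic and every $k$-subset of $E$ is a face. If $\widehat{\mathcal M}$ on $E\cup\{e\}$ has the same rank as $\mathcal M=\widehat{\mathcal M}|_E$ ($\widehat{\mathcal M}$ is a single element extension), then for every cocircuit $X$ of $\mathcal M$ there is a unique sign $\sigma(X)$ with $(X,\sigma(X))$ a cocircuit of $\widehat{\mathcal M}$; the map $\sigma$ is the localization (it takes values in $\{+,-\}$ when $\widehat{\mathcal M}$ is uniform). -}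

module Defs where

open import Data.Nat using (ℕ; zero; suc; _∸_)
open import Data.Fin using (Fin)
open import Data.Bool using (Bool; true; false; if_then_else_)
open import Data.Vec using (Vec; lookup; replicate; map; zipWith; _∷ʳ_)
open import Data.Fin.Subset using (Subset; _⊆_; _∩_; ∣_∣; _∈_; _∉_)
open import Data.Product using (Σ; _×_; _,_; ∃)
open import Relation.Binary.PropositionalEquality using (_≡_; _≢_)
open import Relation.Nullary using (¬_)
open import Function.Bundles using (_⇔_)

data Sign : Set where
  plus minus zer : Sign

SignVec : ℕ → Set
SignVec n = Vec Sign n

neg : Sign → Sign
neg plus = minus
neg minus = plus
neg zer = zer

_∘ˢ_ : Sign → Sign → Sign
zer ∘ˢ y = y
plus ∘ˢ y = plus
minus ∘ˢ y = minus

isZero : Sign → Bool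
isZero zer = true
isZero _ = false

isMinus : Sign → Bool
isMinus minus = true
isMinus _ = false

zeroVec : ∀ {n} → SignVec n
zeroVec = replicate _ zer

negVec : ∀ {n} → SignVec n → SignVec n
negVec = map neg

compose : ∀ {n} → SignVec n → SignVec n → SignVec n
compose = zipWith _∘ˢ_

zeroSet : ∀ {n} → SignVec n → Subset n
zeroSet = map isZero

minusSet : ∀ {n} → SignVec n → Subset n
minusSet = map isMinus

Separates : ∀ {n} → SignVec n → SignVec n → Fin n → Set
Separates X Y e = (lookup X e ≢ zer) × (lookup X e ≡ neg (lookup Y e))

-- A set of covectors (a predicate on sign vectors) satisfying the covector axioms
record IsOrientedMatroid {n : ℕ} (L : SignVec n → Set) : Set where
  field
    cov-zero : L zeroVec
    cov-neg  : ∀ X → L X → L (negVec X)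
    cov-comp : ∀ X Y → L X → L Y → L (compose X Y)
    cov-elim : ∀ X Y → L X → L Y → ∀ e → Separates X Y e →
               Σ (SignVec n) λ Z → L Z × (lookup Z e ≡ zer) ×
                 (∀ f → ¬ Separates X Y f → lookup Z f ≡ lookup (compose X Y) f)

_≤ˢ_ : ∀ {n} → SignVec n → SignVec n → Set
Y ≤ˢ X = ∀ e → (lookup Y e ≡ zer) Data.Sum.⊎ (lookup Y e ≡ lookup X e)
  where import Data.Sum

IsCocircuit : ∀ {n} → (SignVec n → Set) → SignVec n → Set
IsCocircuit L X = L X × (X ≢ zeroVec) ×
  (∀ Y → L Y → Y ≢ zeroVec → Y ≤ˢ X → Y ≡ X)

NonNeg : ∀ {n} → SignVec n → Set
NonNeg X = ∀ e → lookup X e ≢ minus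

-- uniform of rank r: the underlying matroid is U_{r,n}, i.e. its hyperplanes
-- (zero sets of cocircuits) are exactly the (r-1)-subsets of the ground set
IsUniformOfRank : ∀ {n} → (SignVec n → Set) → ℕ → Set
IsUniformOfRank {n} L r =
  ∀ (S : Subset n) → (Σ (SignVec n) λ X → IsCocircuit L X × zeroSet X ≡ S) ⇔ (∣ S ∣ ≡ r ∸ 1)

allPlus : ∀ {n} → SignVec n
allPlus = replicate _ plus

Acyclic : ∀ {n} → (SignVec n → Set) → Set
Acyclic L = L allPlus

IsFace : ∀ {n} → (SignVec n → Set) → Subset n → Set
IsFace L F = L (map (λ b → if b then zer else plus) F)

Neighborly : ∀ {n} → ℕ → (SignVec n → Set) → Set
Neighborly {n} k L = Acyclic L × (∀ (F : Subset n) → ∣ F ∣ ≡ k → IsFace L F)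

RestrictInit : ∀ {n} → (SignVec (suc n) → Set) → SignVec n → Set
RestrictInit L Y = Σ Sign λ s → L (Y ∷ʳ s)

-- σ is the localization of the single element extension M ⊆ M̂ (new element last)
IsLocalization : ∀ {n} → (SignVec (suc n) → Set) → (SignVec n → Sign) → Set
IsLocalization L σ = ∀ X → IsCocircuit (RestrictInit L) X → IsCocircuit L (X ∷ʳ σ X)

zeroSetExt : ∀ {n} → SignVec n → Subset (suc n)
zeroSetExt X = zeroSet X ∷ʳ false

module Submission where

-- Write n for the new element (fromℕ n₀), M = M̂|[n−1] and J = I − n.  The proof
-- rests on one general fact about uniform oriented matroids (conformalCocircuit):
-- every covector X with X(e) ≠ 0 lies conformally above a cocircuit Y with
-- Y(e) = X(e).  It is proved by induction on the number of zeros: uniformity gives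
-- a cocircuit vanishing on Z(X) ∪ {e}, and repeated elimination against X turns it
-- into a covector below X with more zeros.  A cocircuit Y of M̂ with Y(n) ≠ 0 splits
-- as C ∷ʳ σ(C) with C a cocircuit of M (splitCocircuit).  So a covector X that is
-- non-negative off n with X(n) ≠ 0 yields a non-negative cocircuit D of M with
-- σ(D) = X(n) and Z(X) ⊆ Z(D) (signedCocircuit).  Neighborliness supplies such X:
-- if n ∉ I, face(K) for a k-set K ⊇ I avoiding n gives σ(C) = +; if n ∈ I, then for
-- J ⊆ K' ⊆ K with |K'| = k − 1, |K| = k, n ∉ K, face(K) and face(K' + n) ∘ (−face(K))
-- give σ(D) = + and −, and these D meet I exactly in J.

open import Defs
open import Data.Nat using (ℕ; zero; suc; _+_; _∸_; _≤_; _<_; _/_; z≤n; s≤s; _≤?_; _<?_)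
open import Data.Nat.Properties
  using ( ≤-refl; ≤-trans; ≤-reflexive; ≤-pred; <-trans; ≤-<-trans; <⇒≱
        ; ≤-antisym; ≰⇒>; m≤n⇒m≤1+n; m∸n≤m; m≤n+m∸n; ∸-monoʳ-<; ∸-monoˡ-≤; +-comm
        ; +-monoʳ-≤; suc-injective; m+[n∸m]≡n)
open import Data.Nat.DivMod using (m/n≤m)
open import Data.Nat.Induction using (<-wellFounded)
open import Induction.WellFounded using (module All)
import Relation.Binary.Construct.On as On
open import Data.Bool using (true; false; if_then_else_; _∧_)
open import Data.Bool.Properties using (∧-zeroʳ)
open import Data.Fin using (Fin; fromℕ; inject₁) renaming (zero to fzero; suc to fsuc)
open import Data.Fin.Properties using (any?; fromℕ≢inject₁) renaming (_≟_ to _≟ᶠ_)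
open import Data.Vec using (Vec; []; _∷_; lookup; map; _∷ʳ_; _[_]≔_; tabulate; initLast)
open import Data.Vec.Properties
  using ( ≡-dec; []=⇒lookup; lookup⇒[]=; lookup-map; lookup-zipWith; lookup-replicate
        ; lookup∘update; lookup∘update′; lookup∘tabulate; tabulate∘lookup; tabulate-cong
        ; map-∷ʳ)
open import Data.Fin.Subset using (Subset; _⊆_; _∩_; ∣_∣; ⊤)
open import Data.Fin.Subset.Properties using (∣p∣≤n; ∣⊤∣≡n; p⊂q⇒∣p∣<∣q∣)
open import Data.Product using (Σ; ∃; _×_; _,_; proj₁; proj₂)
open import Data.Sum using (_⊎_; inj₁; inj₂)
open import Data.Empty using (⊥-elim)
open import Relation.Nullary using (¬_; Dec; yes; no; does)
open import Relation.Nullary.Decidable using (dec-true; dec-false; ¬?; _×-dec_)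
open import Relation.Binary.PropositionalEquality
  using (_≡_; _≢_; refl; sym; trans; cong; cong₂; subst; module ≡-Reasoning)
open import Function.Bundles using (Equivalence)

measureInduction : {A : Set} (μ : A → ℕ) (P : A → Set) →
  (∀ x → (∀ y → μ y < μ x → P y) → P x) → ∀ x → P x
measureInduction μ P step =
  All.wfRec (On.wellFounded μ <-wellFounded) _ P (λ x rec → step x (λ y → rec))

_≟ˢ_ : (a b : Sign) → Dec (a ≡ b)
plus  ≟ˢ plus  = yes refl
minus ≟ˢ minus = yes refl
zer   ≟ˢ zer   = yes refl
plus  ≟ˢ minus = no λ ()
plus  ≟ˢ zer   = no λ ()
minus ≟ˢ plus  = no λ ()
minus ≟ˢ zer   = no λ ()
zer   ≟ˢ plus  = no λ ()
zer   ≟ˢ minus = no λ ()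

neg-involutive : ∀ a → neg (neg a) ≡ a
neg-involutive plus  = refl
neg-involutive minus = refl
neg-involutive zer   = refl

∘ˢ-nonzero : ∀ {a} b → a ≢ zer → a ∘ˢ b ≡ a
∘ˢ-nonzero {plus}  b _   = refl
∘ˢ-nonzero {minus} b _   = refl
∘ˢ-nonzero {zer}   b a≢0 = ⊥-elim (a≢0 refl)

∘ˢ-idempotent : ∀ a → a ∘ˢ a ≡ a
∘ˢ-idempotent plus  = refl
∘ˢ-idempotent minus = refl
∘ˢ-idempotent zer   = refl

nonzero≢neg : ∀ {a} → a ≢ zer → a ≢ neg a
nonzero≢neg {plus}  _   ()
nonzero≢neg {minus} _   ()
nonzero≢neg {zer}   a≢0 _ = a≢0 refl

nonzero-by : ∀ {a b} → a ≡ b → b ≢ zer → a ≢ zer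
nonzero-by a≡b b≢0 a≡0 = b≢0 (trans (sym a≡b) a≡0)

equal-or-opposite : ∀ {a b} → a ≢ zer → b ≢ zer → a ≡ b ⊎ a ≡ neg b
equal-or-opposite {plus}  {plus}  _ _ = inj₁ refl
equal-or-opposite {plus}  {minus} _ _ = inj₂ refl
equal-or-opposite {minus} {plus}  _ _ = inj₂ refl
equal-or-opposite {minus} {minus} _ _ = inj₁ refl
equal-or-opposite {zer}   a≢0 _ = ⊥-elim (a≢0 refl)
equal-or-opposite {_}     {zer} _ b≢0 = ⊥-elim (b≢0 refl)

zero-or-opposite : ∀ {a b} → b ≢ zer → a ≢ b → a ≡ zer ⊎ a ≡ neg b
zero-or-opposite {a} b≢0 a≢b with a ≟ˢ zer
... | yes a≡0 = inj₁ a≡0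
... | no a≢0 with equal-or-opposite a≢0 b≢0
... | inj₁ a≡b  = ⊥-elim (a≢b a≡b)
... | inj₂ a≡-b = inj₂ a≡-b

conforming : ∀ {a b} → a ≢ zer → a ≢ neg b → b ≡ zer ⊎ b ≡ a
conforming {a} {b} a≢0 a≢-b with b ≟ˢ zer
... | yes b≡0 = inj₁ b≡0
... | no b≢0 with equal-or-opposite b≢0 a≢0
... | inj₁ b≡a  = inj₂ b≡a
... | inj₂ b≡-a = ⊥-elim (a≢-b (trans (sym (neg-involutive a)) (cong neg (sym b≡-a))))

isZero-true : ∀ {a} → isZero a ≡ true → a ≡ zer
isZero-true {zer} _ = refl

isZero-nonzero : ∀ {a} → a ≢ zer → isZero a ≡ false
isZero-nonzero {plus}  _ = refl
isZero-nonzero {minus} _ = refl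
isZero-nonzero {zer}   a≢0 = ⊥-elim (a≢0 refl)

vec-ext : ∀ {A : Set} {n} {xs ys : Vec A n} → (∀ i → lookup xs i ≡ lookup ys i) → xs ≡ ys
vec-ext {xs = xs} {ys} same = begin
  xs                   ≡⟨ sym (tabulate∘lookup xs) ⟩
  tabulate (lookup xs) ≡⟨ tabulate-cong same ⟩
  tabulate (lookup ys) ≡⟨ tabulate∘lookup ys ⟩
  ys                   ∎
  where open ≡-Reasoning

lookup-∷ʳ-last : ∀ {A : Set} {n} (xs : Vec A n) y → lookup (xs ∷ʳ y) (fromℕ n) ≡ y
lookup-∷ʳ-last []       y = refl
lookup-∷ʳ-last (x ∷ xs) y = lookup-∷ʳ-last xs y

lookup-∷ʳ-inject₁ : ∀ {A : Set} {n} (xs : Vec A n) y i → lookup (xs ∷ʳ y) (inject₁ i) ≡ lookup xs i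
lookup-∷ʳ-inject₁ (x ∷ xs) y fzero    = refl
lookup-∷ʳ-inject₁ (x ∷ xs) y (fsuc i) = lookup-∷ʳ-inject₁ xs y i

lookup-∷ʳ-other : ∀ {A : Set} {n} (xs : Vec A n) a b f → f ≢ fromℕ n →
  lookup (xs ∷ʳ a) f ≡ lookup (xs ∷ʳ b) f
lookup-∷ʳ-other []       a b fzero    f≢last = ⊥-elim (f≢last refl)
lookup-∷ʳ-other (x ∷ xs) a b fzero    _      = refl
lookup-∷ʳ-other (x ∷ xs) a b (fsuc f) f≢last = lookup-∷ʳ-other xs a b f (λ eq → f≢last (cong fsuc eq))

differ-at : ∀ {n} (X Y : SignVec n) → X ≢ Y → Σ (Fin n) λ i → lookup X i ≢ lookup Y i
differ-at []      []      X≢Y = ⊥-elim (X≢Y refl)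
differ-at (x ∷ X) (y ∷ Y) X≢Y with x ≟ˢ y
... | no x≢y  = fzero , x≢y
... | yes refl with differ-at X Y (λ eq → X≢Y (cong (x ∷_) eq))
...   | i , Xᵢ≢Yᵢ = fsuc i , Xᵢ≢Yᵢ

lookup-zeroVec : ∀ {n} i → lookup (zeroVec {n}) i ≡ zer
lookup-zeroVec i = lookup-replicate i zer

lookup-compose : ∀ {n} (X Y : SignVec n) i → lookup (compose X Y) i ≡ lookup X i ∘ˢ lookup Y i
lookup-compose X Y i = lookup-zipWith _∘ˢ_ i X Y

lookup-negVec : ∀ {n} (X : SignVec n) i → lookup (negVec X) i ≡ neg (lookup X i)
lookup-negVec X i = lookup-map i neg X

nonzero-witness : ∀ {n} (X : SignVec n) → X ≢ zeroVec → Σ (Fin n) λ i → lookup X i ≢ zer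
nonzero-witness X X≢0 with differ-at X zeroVec X≢0
... | i , differs = i , λ Xᵢ≡0 → differs (trans Xᵢ≡0 (sym (lookup-zeroVec i)))

nonzero-at : ∀ {n} (X : SignVec n) i → lookup X i ≢ zer → X ≢ zeroVec
nonzero-at X i Xᵢ≢0 X≡0 = Xᵢ≢0 (trans (cong (λ V → lookup V i) X≡0) (lookup-zeroVec i))

∷ʳ-nonzero : ∀ {n} (X : SignVec n) a → X ≢ zeroVec → X ∷ʳ a ≢ zeroVec
∷ʳ-nonzero X a X≢0 with nonzero-witness X X≢0
... | i , Xᵢ≢0 =
  nonzero-at (X ∷ʳ a) (inject₁ i) (λ eq → Xᵢ≢0 (trans (sym (lookup-∷ʳ-inject₁ X a i)) eq))

≤ˢ-refl : ∀ {n} {X : SignVec n} → X ≤ˢ X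
≤ˢ-refl i = inj₂ refl

≤ˢ-trans : ∀ {n} {X Y Z : SignVec n} → Z ≤ˢ Y → Y ≤ˢ X → Z ≤ˢ X
≤ˢ-trans Z≤Y Y≤X i with Z≤Y i
... | inj₁ Zᵢ≡0 = inj₁ Zᵢ≡0
... | inj₂ Zᵢ≡Yᵢ with Y≤X i
...   | inj₁ Yᵢ≡0  = inj₁ (trans Zᵢ≡Yᵢ Yᵢ≡0)
...   | inj₂ Yᵢ≡Xᵢ = inj₂ (trans Zᵢ≡Yᵢ Yᵢ≡Xᵢ)

≤ˢ-zero : ∀ {n} {X Y : SignVec n} → Y ≤ˢ X → ∀ i → lookup X i ≡ zer → lookup Y i ≡ zer
≤ˢ-zero Y≤X i Xᵢ≡0 with Y≤X i
... | inj₁ Yᵢ≡0  = Yᵢ≡0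
... | inj₂ Yᵢ≡Xᵢ = trans Yᵢ≡Xᵢ Xᵢ≡0

≤ˢ-nonneg : ∀ {n} {X Y : SignVec n} → Y ≤ˢ X → ∀ i → lookup X i ≢ minus → lookup Y i ≢ minus
≤ˢ-nonneg Y≤X i Xᵢ≢- Yᵢ≡- with Y≤X i
... | inj₁ Yᵢ≡0  = zer≢minus (trans (sym Yᵢ≡0) Yᵢ≡-)
  where
  zer≢minus : zer ≢ minus
  zer≢minus ()
... | inj₂ Yᵢ≡Xᵢ = Xᵢ≢- (trans (sym Yᵢ≡Xᵢ) Yᵢ≡-)

infix 4 _⊑_
_⊑_ : ∀ {n} → Subset n → Subset n → Set
p ⊑ q = ∀ i → lookup p i ≡ true → lookup q i ≡ true

⊑⇒⊆ : ∀ {n} {p q : Subset n} → p ⊑ q → p ⊆ q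
⊑⇒⊆ {p = p} {q} p⊑q {i} i∈p = lookup⇒[]= i q (p⊑q i ([]=⇒lookup i∈p))

⊑-card-strict : ∀ {n} (p q : Subset n) x → p ⊑ q → lookup q x ≡ true → lookup p x ≡ false →
  ∣ p ∣ < ∣ q ∣
⊑-card-strict p q x p⊑q qₓ pₓ =
  p⊂q⇒∣p∣<∣q∣ {p = p} {q}
    (⊑⇒⊆ p⊑q , x , lookup⇒[]= x q qₓ , λ x∈p → true≢false (trans (sym ([]=⇒lookup x∈p)) pₓ))
  where
  true≢false : true ≢ false
  true≢false ()

extend : ∀ {n} (A C : Subset n) t → A ⊑ C → ∣ A ∣ ≤ t → t ≤ ∣ C ∣ →
  Σ (Subset n) λ B → A ⊑ B × B ⊑ C × ∣ B ∣ ≡ t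
extend []          []          zero    _   _       _       = [] , (λ ()) , (λ ()) , refl
extend (true ∷ A)  (true ∷ C)  (suc t) A⊑C (s≤s a) (s≤s c) with extend A C t (λ i → A⊑C (fsuc i)) a c
... | B , A⊑B , B⊑C , ∣B∣ = true ∷ B , (λ { fzero _ → refl ; (fsuc i) → A⊑B i })
                                    , (λ { fzero _ → refl ; (fsuc i) → B⊑C i }) , cong suc ∣B∣
extend (true ∷ A)  (false ∷ C) t       A⊑C _       _ with A⊑C fzero refl
... | ()
extend (false ∷ A) (false ∷ C) t       A⊑C a       c with extend A C t (λ i → A⊑C (fsuc i)) a c
... | B , A⊑B , B⊑C , ∣B∣ = false ∷ B , (λ { fzero () ; (fsuc i) → A⊑B i })
                                     , (λ { fzero () ; (fsuc i) → B⊑C i }) , ∣B∣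
extend (false ∷ A) (true ∷ C)  t       A⊑C a       c with t ≤? ∣ C ∣
... | yes t≤∣C∣ with extend A C t (λ i → A⊑C (fsuc i)) a t≤∣C∣
...   | B , A⊑B , B⊑C , ∣B∣ = false ∷ B , (λ { fzero () ; (fsuc i) → A⊑B i })
                                       , (λ { fzero _ → refl ; (fsuc i) → B⊑C i }) , ∣B∣
extend (false ∷ A) (true ∷ C)  t       A⊑C a       c | no t≰∣C∣ =
  true ∷ C , (λ { fzero () ; (fsuc i) → A⊑C (fsuc i) }) , (λ i Cᵢ → Cᵢ) , ≤-antisym (≰⇒> t≰∣C∣) c

insert-card : ∀ {n} (p : Subset n) x → lookup p x ≡ false → ∣ p [ x ]≔ true ∣ ≡ suc ∣ p ∣
insert-card (false ∷ p) fzero    _  = refl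
insert-card (true ∷ p)  (fsuc x) pₓ = cong suc (insert-card p x pₓ)
insert-card (false ∷ p) (fsuc x) pₓ = insert-card p x pₓ

remove-card : ∀ {n} (p : Subset n) x → lookup p x ≡ true → suc ∣ p [ x ]≔ false ∣ ≡ ∣ p ∣
remove-card (true ∷ p)  fzero    _  = refl
remove-card (true ∷ p)  (fsuc x) pₓ = cong suc (remove-card p x pₓ)
remove-card (false ∷ p) (fsuc x) pₓ = remove-card p x pₓ

⊑-insert : ∀ {n} (p : Subset n) x → p ⊑ p [ x ]≔ true
⊑-insert p x i pᵢ with i ≟ᶠ x
... | yes refl = lookup∘update x p true
... | no i≢x   = trans (lookup∘update′ i≢x p true) pᵢ

allBut : ∀ {n} → Fin n → Subset n
allBut e = ⊤ [ e ]≔ false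

allBut-card : ∀ {n} (e : Fin (suc n)) → ∣ allBut e ∣ ≡ n
allBut-card {n} e = suc-injective (trans (remove-card ⊤ e (lookup-replicate e true)) (∣⊤∣≡n (suc n)))

avoids⇒⊑allBut : ∀ {n} (A : Subset n) e → lookup A e ≡ false → A ⊑ allBut e
avoids⇒⊑allBut A e Aₑ i Aᵢ with i ≟ᶠ e
... | no i≢e   = trans (lookup∘update′ i≢e ⊤ false) (lookup-replicate i true)
... | yes refl with trans (sym Aᵢ) Aₑ
...   | ()

⊑allBut⇒avoids : ∀ {n} (A : Subset n) e → A ⊑ allBut e → lookup A e ≡ false
⊑allBut⇒avoids A e A⊑ with lookup A e in Aₑ
... | false = refl
... | true with trans (sym (A⊑ e Aₑ)) (lookup∘update e ⊤ false)
...   | ()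

extendAvoiding : ∀ {n} (A : Subset (suc n)) e t → lookup A e ≡ false → ∣ A ∣ ≤ t → t ≤ n →
  Σ (Subset (suc n)) λ K → A ⊑ K × lookup K e ≡ false × ∣ K ∣ ≡ t
extendAvoiding A e t Aₑ ∣A∣≤t t≤n
  with extend A (allBut e) t (avoids⇒⊑allBut A e Aₑ) ∣A∣≤t
              (≤-trans t≤n (≤-reflexive (sym (allBut-card e))))
... | K , A⊑K , K⊑allBut , ∣K∣ = K , A⊑K , ⊑allBut⇒avoids K e K⊑allBut , ∣K∣

∩-remove : ∀ {n} (Z I : Subset n) e → lookup Z e ≡ false → I [ e ]≔ false ⊑ Z →
  Z ∩ I ≡ I [ e ]≔ false
∩-remove Z I e Zₑ J⊑Z = vec-ext λ i → trans (lookup-zipWith _∧_ i Z I) (pointwise i)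
  where
  pointwise : ∀ i → (lookup Z i ∧ lookup I i) ≡ lookup (I [ e ]≔ false) i
  pointwise i with i ≟ᶠ e
  ... | yes refl = trans (cong (_∧ lookup I e) Zₑ) (sym (lookup∘update e I false))
  ... | no i≢e   = off-e (lookup∘update′ i≢e I false)
    where
    off-e : lookup (I [ e ]≔ false) i ≡ lookup I i → (lookup Z i ∧ lookup I i) ≡ lookup (I [ e ]≔ false) i
    off-e Jᵢ≡Iᵢ with lookup I i
    ... | false = trans (∧-zeroʳ (lookup Z i)) (sym Jᵢ≡Iᵢ)
    ... | true  = trans (cong (_∧ true) (J⊑Z i Jᵢ≡Iᵢ)) (sym Jᵢ≡Iᵢ)

zeros : ∀ {n} → SignVec n → ℕ
zeros X = ∣ zeroSet X ∣

zeroSet-∋ : ∀ {n} (X : SignVec n) i → lookup X i ≡ zer → lookup (zeroSet X) i ≡ true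
zeroSet-∋ X i Xᵢ≡0 = trans (lookup-map i isZero X) (cong isZero Xᵢ≡0)

zeroSet-∌ : ∀ {n} (X : SignVec n) i → lookup X i ≢ zer → lookup (zeroSet X) i ≡ false
zeroSet-∌ X i Xᵢ≢0 = trans (lookup-map i isZero X) (isZero-nonzero Xᵢ≢0)

zeroSet-zero : ∀ {n} (X : SignVec n) i → lookup (zeroSet X) i ≡ true → lookup X i ≡ zer
zeroSet-zero X i i∈Z = isZero-true (trans (sym (lookup-map i isZero X)) i∈Z)

≤ˢ-zeroSet : ∀ {n} {X Y : SignVec n} → Y ≤ˢ X → zeroSet X ⊑ zeroSet Y
≤ˢ-zeroSet {X = X} {Y} Y≤X i i∈Z = zeroSet-∋ Y i (≤ˢ-zero {X = X} {Y} Y≤X i (zeroSet-zero X i i∈Z))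

≤ˢ-strict-zeros : ∀ {n} {X Y : SignVec n} → Y ≤ˢ X → Y ≢ X → zeros X < zeros Y
≤ˢ-strict-zeros {X = X} {Y} Y≤X Y≢X with differ-at Y X Y≢X
... | i , Yᵢ≢Xᵢ with Y≤X i
...   | inj₂ Yᵢ≡Xᵢ = ⊥-elim (Yᵢ≢Xᵢ Yᵢ≡Xᵢ)
...   | inj₁ Yᵢ≡0  = ⊑-card-strict (zeroSet X) (zeroSet Y) i (≤ˢ-zeroSet {X = X} {Y} Y≤X)
                       (zeroSet-∋ Y i Yᵢ≡0)
                       (zeroSet-∌ X i (λ Xᵢ≡0 → Yᵢ≢Xᵢ (trans Yᵢ≡0 (sym Xᵢ≡0))))

zeros-zeroVec : ∀ n → zeros (zeroVec {n}) ≡ n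
zeros-zeroVec zero    = refl
zeros-zeroVec (suc n) = cong suc (zeros-zeroVec n)

zeroSet-∷ʳ : ∀ {n} (X : SignVec n) a → zeroSet (X ∷ʳ a) ≡ zeroSet X ∷ʳ isZero a
zeroSet-∷ʳ X a = map-∷ʳ isZero a X

card-∷ʳ-false : ∀ {n} (p : Subset n) → ∣ p ∷ʳ false ∣ ≡ ∣ p ∣
card-∷ʳ-false []          = refl
card-∷ʳ-false (true ∷ p)  = cong suc (card-∷ʳ-false p)
card-∷ʳ-false (false ∷ p) = card-∷ʳ-false p

card-∷ʳ-true : ∀ {n} (p : Subset n) → ∣ p ∷ʳ true ∣ ≡ suc ∣ p ∣
card-∷ʳ-true []          = refl
card-∷ʳ-true (true ∷ p)  = cong suc (card-∷ʳ-true p)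
card-∷ʳ-true (false ∷ p) = card-∷ʳ-true p

zeros-∷ʳ-nonzero : ∀ {n} (X : SignVec n) {a} → a ≢ zer → zeros (X ∷ʳ a) ≡ zeros X
zeros-∷ʳ-nonzero X {a} a≢0 = begin
  ∣ zeroSet (X ∷ʳ a) ∣       ≡⟨ cong ∣_∣ (zeroSet-∷ʳ X a) ⟩
  ∣ zeroSet X ∷ʳ isZero a ∣  ≡⟨ cong (λ b → ∣ zeroSet X ∷ʳ b ∣) (isZero-nonzero a≢0) ⟩
  ∣ zeroSet X ∷ʳ false ∣     ≡⟨ card-∷ʳ-false (zeroSet X) ⟩
  ∣ zeroSet X ∣              ∎
  where open ≡-Reasoning

zeros-∷ʳ-zer : ∀ {n} (X : SignVec n) → zeros (X ∷ʳ zer) ≡ suc (zeros X)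
zeros-∷ʳ-zer X = trans (cong ∣_∣ (zeroSet-∷ʳ X zer)) (card-∷ʳ-true (zeroSet X))

zeros-∷ʳ-≥ : ∀ {n} (X : SignVec n) a → zeros X ≤ zeros (X ∷ʳ a)
zeros-∷ʳ-≥ X zer   = ≤-trans (m≤n⇒m≤1+n ≤-refl) (≤-reflexive (sym (zeros-∷ʳ-zer X)))
zeros-∷ʳ-≥ X plus  = ≤-reflexive (sym (zeros-∷ʳ-nonzero X {plus} (λ ())))
zeros-∷ʳ-≥ X minus = ≤-reflexive (sym (zeros-∷ʳ-nonzero X {minus} (λ ())))

moreZerosInduction : ∀ {n} (P : SignVec n → Set) →
  (∀ X → (∀ Y → zeros X < zeros Y → P Y) → P X) → ∀ X → P X
moreZerosInduction {n} P step = measureInduction (λ X → n ∸ zeros X) P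
  (λ X rec → step X (λ Y more → rec Y (∸-monoʳ-< more (∣p∣≤n (zeroSet Y)))))

faceVector : ∀ {n} → Subset n → SignVec n
faceVector = map (λ b → if b then zer else plus)

lookup-faceVector : ∀ {n} (K : Subset n) i → lookup (faceVector K) i ≡ (if lookup K i then zer else plus)
lookup-faceVector K i = lookup-map i _ K

faceVector-∋ : ∀ {n} (K : Subset n) i → lookup K i ≡ true → lookup (faceVector K) i ≡ zer
faceVector-∋ K i Kᵢ = trans (lookup-faceVector K i) (cong (λ b → if b then zer else plus) Kᵢ)

faceVector-∌ : ∀ {n} (K : Subset n) i → lookup K i ≡ false → lookup (faceVector K) i ≡ plus
faceVector-∌ K i Kᵢ = trans (lookup-faceVector K i) (cong (λ b → if b then zer else plus) Kᵢ)

faceVector-zeros : ∀ {n} (A K : Subset n) → A ⊑ K → A ⊑ zeroSet (faceVector K)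
faceVector-zeros A K A⊑K i Aᵢ = zeroSet-∋ (faceVector K) i (faceVector-∋ K i (A⊑K i Aᵢ))

faceVector-nonneg : ∀ {n} (K : Subset n) i → lookup (faceVector K) i ≢ minus
faceVector-nonneg K i rewrite lookup-faceVector K i with lookup K i
... | true  = λ ()
... | false = λ ()

-- face(K' + e) ∘ (−face(K)): for K' ⊆ K avoiding e it is − at e, 0 on K', + elsewhere.
flipVector : ∀ {n} → Subset n → Subset n → Fin n → SignVec n
flipVector K' K e = compose (faceVector (K' [ e ]≔ true)) (negVec (faceVector K))

lookup-flipVector : ∀ {n} (K' K : Subset n) e i →
  lookup (flipVector K' K e) i ≡ lookup (faceVector (K' [ e ]≔ true)) i ∘ˢ neg (lookup (faceVector K) i)
lookup-flipVector K' K e i = trans (lookup-compose (faceVector (K' [ e ]≔ true)) (negVec (faceVector K)) i)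
    (cong (lookup (faceVector (K' [ e ]≔ true)) i ∘ˢ_) (lookup-negVec (faceVector K) i))

flipVector-at : ∀ {n} (K' K : Subset n) e → lookup K e ≡ false → lookup (flipVector K' K e) e ≡ minus
flipVector-at K' K e Kₑ = begin
  lookup (flipVector K' K e) e                                         ≡⟨ lookup-flipVector K' K e e ⟩
  lookup (faceVector (K' [ e ]≔ true)) e ∘ˢ neg (lookup (faceVector K) e)
    ≡⟨ cong₂ (λ a b → a ∘ˢ neg b) (faceVector-∋ (K' [ e ]≔ true) e (lookup∘update e K' true))
                                  (faceVector-∌ K e Kₑ) ⟩
  minus                                                                ∎
  where open ≡-Reasoning

flipVector-zeros : ∀ {n} (A K' K : Subset n) e → A ⊑ K' → K' ⊑ K → A ⊑ zeroSet (flipVector K' K e)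
flipVector-zeros A K' K e A⊑K' K'⊑K i Aᵢ = zeroSet-∋ (flipVector K' K e) i (begin
  lookup (flipVector K' K e) i                                         ≡⟨ lookup-flipVector K' K e i ⟩
  lookup (faceVector (K' [ e ]≔ true)) i ∘ˢ neg (lookup (faceVector K) i)
    ≡⟨ cong₂ (λ a b → a ∘ˢ neg b) (faceVector-∋ (K' [ e ]≔ true) i (⊑-insert K' e i K'ᵢ))
                                  (faceVector-∋ K i (K'⊑K i K'ᵢ)) ⟩
  zer                                                                  ∎)
  where
  open ≡-Reasoning
  K'ᵢ : lookup K' i ≡ true
  K'ᵢ = A⊑K' i Aᵢ

flipVector-nonneg : ∀ {n} (K' K : Subset n) e → K' ⊑ K →
  ∀ i → i ≢ e → lookup (flipVector K' K e) i ≢ minus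
flipVector-nonneg K' K e K'⊑K i i≢e rewrite lookup-flipVector K' K e i
  with lookup (K' [ e ]≔ true) i in K'ᵢ
... | false rewrite faceVector-∌ (K' [ e ]≔ true) i K'ᵢ = λ ()
... | true  rewrite faceVector-∋ (K' [ e ]≔ true) i K'ᵢ
                  | faceVector-∋ K i (K'⊑K i (trans (sym (lookup∘update′ i≢e K' true)) K'ᵢ)) = λ ()

separates? : ∀ {n} (X Y : SignVec n) e → Dec (Separates X Y e)
separates? X Y e = ¬? (lookup X e ≟ˢ zer) ×-dec (lookup X e ≟ˢ neg (lookup Y e))

conforming-unseparated : ∀ {n} (W V : SignVec n) f →
  lookup V f ≡ zer ⊎ lookup V f ≡ lookup W f → ¬ Separates W V f
conforming-unseparated W V f (inj₁ V≡0) (W≢0 , W≡-V) = W≢0 (trans W≡-V (cong neg V≡0))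
conforming-unseparated W V f (inj₂ V≡W) (W≢0 , W≡-V) = nonzero≢neg W≢0 (trans W≡-V (cong neg V≡W))

-- Uniform oriented matroids of rank r on n elements

module UniformOM {n : ℕ} {L : SignVec n → Set} (om : IsOrientedMatroid L)
                 {r : ℕ} (unif : IsUniformOfRank L r) (1≤r : 1 ≤ r) (r≤n : r ≤ n) where

  open IsOrientedMatroid om

  cocircuit-zeros : ∀ {X} → IsCocircuit L X → zeros X ≡ r ∸ 1
  cocircuit-zeros {X} cX = Equivalence.to (unif (zeroSet X)) (X , cX , refl)

  maximal⇒cocircuit : ∀ X → L X → X ≢ zeroVec →
    (∀ Y → L Y → Y ≢ zeroVec → ¬ zeros X < zeros Y) → IsCocircuit L X
  maximal⇒cocircuit X LX X≢0 maximal = LX , X≢0 , minimal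
    where
    minimal : ∀ Y → L Y → Y ≢ zeroVec → Y ≤ˢ X → Y ≡ X
    minimal Y LY Y≢0 Y≤X with ≡-dec _≟ˢ_ Y X
    ... | yes Y≡X = Y≡X
    ... | no Y≢X  = ⊥-elim (maximal Y LY Y≢0 (≤ˢ-strict-zeros {X = X} {Y} Y≤X Y≢X))

  zeros-bound : ∀ X → L X → X ≢ zeroVec → zeros X < r
  zeros-bound = moreZerosInduction _ step
    where
    step : ∀ X → (∀ Y → zeros X < zeros Y → L Y → Y ≢ zeroVec → zeros Y < r) →
           L X → X ≢ zeroVec → zeros X < r
    step X ih LX X≢0 with zeros X <? r
    ... | yes below = below
    ... | no ¬below = ⊥-elim (¬below (≤-<-trans (≤-reflexive (cocircuit-zeros cX)) r∸1<r))
      where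
      r∸1<r : r ∸ 1 < r
      r∸1<r = ∸-monoʳ-< (s≤s z≤n) 1≤r
      cX : IsCocircuit L X
      cX = maximal⇒cocircuit X LX X≢0 λ Y LY Y≢0 more → ¬below (<-trans more (ih Y more LY Y≢0))

  cocircuit-through : ∀ A → ∣ A ∣ ≤ r ∸ 1 → Σ (SignVec n) λ U → IsCocircuit L U × A ⊑ zeroSet U
  cocircuit-through A ∣A∣≤r-1
    with extend A ⊤ (r ∸ 1) (λ i _ → lookup-replicate i true) ∣A∣≤r-1
                 (≤-trans (m∸n≤m r 1) (≤-trans r≤n (≤-reflexive (sym (∣⊤∣≡n n)))))
  ... | S , A⊑S , _ , ∣S∣ with Equivalence.from (unif S) ∣S∣
  ...   | U , cU , refl = U , cU , A⊑S

  -- Approaching a covector W from below by eliminations, keeping W(e) ≠ 0.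
  module Approach (W : SignVec n) (LW : L W) (e : Fin n) (Wₑ≢0 : lookup W e ≢ zer) where

    Vanishes : SignVec n → Set
    Vanishes V = ∀ f → lookup W f ≡ zer → lookup V f ≡ zer

    Approximant : SignVec n → Set
    Approximant V = L V × lookup V e ≡ lookup W e × Vanishes V ×
                    (Σ (Fin n) λ x → lookup W x ≢ zer × lookup V x ≡ zer)

    separation : SignVec n → Subset n
    separation V = tabulate (λ f → does (separates? W V f))

    separation-∋ : ∀ V f → Separates W V f → lookup (separation V) f ≡ true
    separation-∋ V f sep = trans (lookup∘tabulate _ f) (dec-true (separates? W V f) sep)

    separation-∌ : ∀ V f → ¬ Separates W V f → lookup (separation V) f ≡ false
    separation-∌ V f ¬sep = trans (lookup∘tabulate _ f) (dec-false (separates? W V f) ¬sep)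

    separation-⊑ : ∀ Z V → (∀ f → Separates W Z f → Separates W V f) → separation Z ⊑ separation V
    separation-⊑ Z V inherits f f∈sepZ with separates? W Z f
    ... | yes sep = separation-∋ V f (inherits f sep)
    ... | no ¬sep with trans (sym f∈sepZ) (separation-∌ Z f ¬sep)
    ...   | ()

    eliminate : ∀ V → L V → ¬ Separates W V e → Vanishes V → ∀ h → Separates W V h →
      Σ (SignVec n) λ Z → L Z × lookup Z e ≡ lookup W e × Vanishes Z × lookup Z h ≡ zer ×
                           ∣ separation Z ∣ < ∣ separation V ∣
    eliminate V LV ¬sepₑ vanV h sepₕ with cov-elim W V LW LV h sepₕ
    ... | Z , LZ , Zₕ≡0 , agree = Z , LZ , Zₑ , vanZ , Zₕ≡0 , fewer
      where
      Z≡W∘V : ∀ f → ¬ Separates W V f → lookup Z f ≡ lookup W f ∘ˢ lookup V f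
      Z≡W∘V f ¬sep = trans (agree f ¬sep) (lookup-compose W V f)
      Zₑ : lookup Z e ≡ lookup W e
      Zₑ = trans (Z≡W∘V e ¬sepₑ) (∘ˢ-nonzero _ Wₑ≢0)
      vanZ : Vanishes Z
      vanZ f W≡0 = trans (Z≡W∘V f (λ sep → proj₁ sep W≡0))
                         (trans (cong (_∘ˢ lookup V f) W≡0) (vanV f W≡0))
      inherits : ∀ f → Separates W Z f → Separates W V f
      inherits f (W≢0 , W≡-Z) with separates? W V f
      ... | yes sep = sep
      ... | no ¬sep = ⊥-elim (nonzero≢neg W≢0
                        (trans W≡-Z (cong neg (trans (Z≡W∘V f ¬sep) (∘ˢ-nonzero _ W≢0)))))
      fewer : ∣ separation Z ∣ < ∣ separation V ∣
      fewer = ⊑-card-strict (separation Z) (separation V) h (separation-⊑ Z V inherits) (separation-∋ V h sepₕ)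
                (separation-∌ Z h (conforming-unseparated W Z h (inj₁ Zₕ≡0)))

    -- Eliminating until no separation is left yields an approximant conformal to W.
    conformalise : ∀ V → Approximant V → Σ (SignVec n) λ V' → V' ≤ˢ W × Approximant V'
    conformalise = measureInduction (λ V → ∣ separation V ∣) _ step
      where
      step : ∀ V → (∀ U → ∣ separation U ∣ < ∣ separation V ∣ → Approximant U →
                      Σ (SignVec n) λ V' → V' ≤ˢ W × Approximant V') →
             Approximant V → Σ (SignVec n) λ V' → V' ≤ˢ W × Approximant V'
      step V ih approxV@(LV , Vₑ , vanV , _) with any? (separates? W V)
      ... | yes (h , sepₕ) with eliminate V LV (conforming-unseparated W V e (inj₂ Vₑ)) vanV h sepₕ
      ...   | Z , LZ , Zₑ , vanZ , Zₕ≡0 , fewer = ih Z fewer (LZ , Zₑ , vanZ , h , proj₁ sepₕ , Zₕ≡0)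
      step V ih approxV@(LV , Vₑ , vanV , _) | no unseparated = V , V≤W , approxV
        where
        V≤W : V ≤ˢ W
        V≤W f with lookup W f ≟ˢ zer
        ... | yes W≡0 = inj₁ (vanV f W≡0)
        ... | no W≢0  = conforming W≢0 (λ W≡-V → unseparated (f , W≢0 , W≡-V))

    separated-sign : ∀ U → U ≢ zeroVec → Vanishes U →
      ∃ λ h → Separates W U h ⊎ Separates W (negVec U) h
    separated-sign U U≢0 vanU with nonzero-witness U U≢0
    ... | h , Uₕ≢0 = h , signed (equal-or-opposite Wₕ≢0 Uₕ≢0)
      where
      Wₕ≢0 : lookup W h ≢ zer
      Wₕ≢0 W≡0 = Uₕ≢0 (vanU h W≡0)
      signed : lookup W h ≡ lookup U h ⊎ lookup W h ≡ neg (lookup U h) →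
               Separates W U h ⊎ Separates W (negVec U) h
      signed (inj₂ W≡-U) = inj₁ (Wₕ≢0 , W≡-U)
      signed (inj₁ W≡U)  = inj₂ (Wₕ≢0 , trans W≡U (trans (sym (neg-involutive _))
                                                    (cong neg (sym (lookup-negVec U h)))))

    approximant-at : ∀ V → L V → lookup V e ≡ zer → Vanishes V → ∀ h → Separates W V h →
      Σ (SignVec n) Approximant
    approximant-at V LV Vₑ≡0 vanV h sepₕ
      with eliminate V LV (conforming-unseparated W V e (inj₁ Vₑ≡0)) vanV h sepₕ
    ... | Z , LZ , Zₑ , vanZ , Zₕ≡0 , _ = Z , LZ , Zₑ , vanZ , h , proj₁ sepₕ , Zₕ≡0

    initialApproximant : ∀ U → L U → U ≢ zeroVec → lookup U e ≡ zer → Vanishes U →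
      Σ (SignVec n) Approximant
    initialApproximant U LU U≢0 Uₑ≡0 vanU with separated-sign U U≢0 vanU
    ... | h , inj₁ sep = approximant-at U LU Uₑ≡0 vanU h sep
    ... | h , inj₂ sep = approximant-at (negVec U) (cov-neg U LU)
                           (trans (lookup-negVec U e) (cong neg Uₑ≡0)) negVanishes h sep
      where
      negVanishes : Vanishes (negVec U)
      negVanishes f W≡0 = trans (lookup-negVec U f) (cong neg (vanU f W≡0))

    moreZerosBelow : ∀ U → L U → U ≢ zeroVec → lookup U e ≡ zer → Vanishes U →
      Σ (SignVec n) λ V → L V × V ≤ˢ W × lookup V e ≡ lookup W e × zeros W < zeros V
    moreZerosBelow U LU U≢0 Uₑ≡0 vanU with initialApproximant U LU U≢0 Uₑ≡0 vanU
    ... | V₀ , approx₀ with conformalise V₀ approx₀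
    ...   | V , V≤W , LV , Vₑ , _ , x , Wₓ≢0 , Vₓ≡0 =
      V , LV , V≤W , Vₑ , ⊑-card-strict (zeroSet W) (zeroSet V) x (≤ˢ-zeroSet {X = W} {V} V≤W)
                            (zeroSet-∋ V x Vₓ≡0) (zeroSet-∌ W x Wₓ≢0)

  -- A covector W with W(e) ≠ 0 and fewer than r − 1 zeros lies conformally above a
  -- covector with the same sign at e and more zeros: by uniformity some cocircuit
  -- vanishes on Z(W) ∪ {e}, and eliminating it against W makes it conformal.
  strictlyBelow : ∀ W → L W → ∀ e → lookup W e ≢ zer → zeros W < r ∸ 1 →
    Σ (SignVec n) λ V → L V × V ≤ˢ W × lookup V e ≡ lookup W e × zeros W < zeros V
  strictlyBelow W LW e Wₑ≢0 room
    with cocircuit-through (zeroSet W [ e ]≔ true)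
           (≤-trans (≤-reflexive (insert-card (zeroSet W) e (zeroSet-∌ W e Wₑ≢0))) room)
  ... | U , (LU , U≢0 , _) , A⊑Z = Approach.moreZerosBelow W LW e Wₑ≢0 U LU U≢0 Uₑ≡0 vanU
    where
    Uₑ≡0 : lookup U e ≡ zer
    Uₑ≡0 = zeroSet-zero U e (A⊑Z e (lookup∘update e (zeroSet W) true))
    vanU : Approach.Vanishes W LW e Wₑ≢0 U
    vanU f W≡0 = zeroSet-zero U f (A⊑Z f (⊑-insert (zeroSet W) e f (zeroSet-∋ W f W≡0)))

  conformalCocircuit : ∀ W → L W → ∀ e → lookup W e ≢ zer →
    Σ (SignVec n) λ Y → IsCocircuit L Y × Y ≤ˢ W × lookup Y e ≡ lookup W e
  conformalCocircuit W LW e = moreZerosInduction P step W LW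
    where
    P : SignVec n → Set
    P W = L W → lookup W e ≢ zer → Σ (SignVec n) λ Y → IsCocircuit L Y × Y ≤ˢ W × lookup Y e ≡ lookup W e
    step : ∀ W → (∀ V → zeros W < zeros V → P V) → P W
    step W ih LW Wₑ≢0 with r ∸ 1 ≤? zeros W
    ... | yes full = W , maximal⇒cocircuit W LW (nonzero-at W e Wₑ≢0) noMore , ≤ˢ-refl {X = W} , refl
      where
      noMore : ∀ Y → L Y → Y ≢ zeroVec → ¬ zeros W < zeros Y
      noMore Y LY Y≢0 more =
        <⇒≱ (zeros-bound Y LY Y≢0) (≤-trans (m≤n+m∸n r 1) (≤-trans (s≤s full) more))
    ... | no room = descend (strictlyBelow W LW e Wₑ≢0 (≰⇒> room))
      where
      descend : (Σ (SignVec n) λ V → L V × V ≤ˢ W × lookup V e ≡ lookup W e × zeros W < zeros V) →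
                Σ (SignVec n) λ Y → IsCocircuit L Y × Y ≤ˢ W × lookup Y e ≡ lookup W e
      descend (V , LV , V≤W , Vₑ , more) =
        let (Y , cY , Y≤V , Yₑ) = ih V more LV (nonzero-by Vₑ Wₑ≢0)
        in  Y , cY , ≤ˢ-trans {X = W} {V} {Y} Y≤V V≤W , trans Yₑ Vₑ

-- Single element extensions: M̂ on n₀ + 1 elements, the new element is the last one

module Extension {n₀ : ℕ} {L : SignVec (suc n₀) → Set} (om : IsOrientedMatroid L)
                 {r : ℕ} (unif : IsUniformOfRank L r) (1≤r : 1 ≤ r) (r≤n₀ : r ≤ n₀)
                 {σ : SignVec n₀ → Sign} (loc : IsLocalization L σ) where

  open IsOrientedMatroid om
  open UniformOM om unif 1≤r (m≤n⇒m≤1+n r≤n₀)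

  new : Fin (suc n₀)
  new = fromℕ n₀

  -- A nonzero C with r − 1 zeros cannot be extended by 0 to a covector (it would have r zeros).
  noZeroExtension : ∀ C → C ≢ zeroVec → zeros C ≡ r ∸ 1 → ¬ L (C ∷ʳ zer)
  noZeroExtension C C≢0 ∣ZC∣ LC0 =
    <⇒≱ (zeros-bound (C ∷ʳ zer) LC0 (∷ʳ-nonzero C zer C≢0))
        (≤-trans (m≤n+m∸n r 1) (≤-reflexive (sym (trans (zeros-∷ʳ-zer C) (cong suc ∣ZC∣)))))

  lastSeparates : ∀ C {a} → a ≢ zer → Separates (C ∷ʳ a) (C ∷ʳ neg a) new
  lastSeparates C {a} a≢0 =
    nonzero-by (lookup-∷ʳ-last C a) a≢0 ,
    trans (lookup-∷ʳ-last C a) (trans (sym (neg-involutive a)) (cong neg (sym (lookup-∷ʳ-last C (neg a)))))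

  oppositeExtensions : ∀ C {a} → a ≢ zer → L (C ∷ʳ a) → L (C ∷ʳ neg a) → L (C ∷ʳ zer)
  oppositeExtensions C {a} a≢0 L⁺ L⁻
    with cov-elim (C ∷ʳ a) (C ∷ʳ neg a) L⁺ L⁻ new (lastSeparates C a≢0)
  ... | Z , LZ , Zₙ≡0 , agree = subst L (vec-ext same) LZ
    where
    same : ∀ f → lookup Z f ≡ lookup (C ∷ʳ zer) f
    same f with f ≟ᶠ new
    ... | yes refl = trans Zₙ≡0 (sym (lookup-∷ʳ-last C zer))
    ... | no f≢new = begin
      lookup Z f                                     ≡⟨ agree f unseparated ⟩
      lookup (compose (C ∷ʳ a) (C ∷ʳ neg a)) f        ≡⟨ lookup-compose (C ∷ʳ a) (C ∷ʳ neg a) f ⟩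
      lookup (C ∷ʳ a) f ∘ˢ lookup (C ∷ʳ neg a) f      ≡⟨ cong (lookup (C ∷ʳ a) f ∘ˢ_) (sym sameₐ) ⟩
      lookup (C ∷ʳ a) f ∘ˢ lookup (C ∷ʳ a) f          ≡⟨ ∘ˢ-idempotent _ ⟩
      lookup (C ∷ʳ a) f                              ≡⟨ lookup-∷ʳ-other C a zer f f≢new ⟩
      lookup (C ∷ʳ zer) f                            ∎
      where
      open ≡-Reasoning
      sameₐ : lookup (C ∷ʳ a) f ≡ lookup (C ∷ʳ neg a) f
      sameₐ = lookup-∷ʳ-other C a (neg a) f f≢new
      unseparated : ¬ Separates (C ∷ʳ a) (C ∷ʳ neg a) f
      unseparated = conforming-unseparated (C ∷ʳ a) (C ∷ʳ neg a) f (inj₂ (sym sameₐ))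

  prefix-zeros : ∀ C {a} → a ≢ zer → IsCocircuit L (C ∷ʳ a) → zeros C ≡ r ∸ 1
  prefix-zeros C a≢0 cCa = trans (sym (zeros-∷ʳ-nonzero C a≢0)) (cocircuit-zeros cCa)

  restrictCocircuit : ∀ C {a} → a ≢ zer → IsCocircuit L (C ∷ʳ a) → IsCocircuit (RestrictInit L) C
  restrictCocircuit C {a} a≢0 cCa = (a , proj₁ cCa) , C≢0 , minimal
    where
    ∣ZC∣ : zeros C ≡ r ∸ 1
    ∣ZC∣ = prefix-zeros C a≢0 cCa
    C≢0 : C ≢ zeroVec
    C≢0 C≡0 = <⇒≱ (≤-<-trans (≤-reflexive ∣ZC∣) (∸-monoʳ-< (s≤s z≤n) 1≤r))
                  (≤-trans r≤n₀ (≤-reflexive (sym (trans (cong zeros C≡0) (zeros-zeroVec n₀)))))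
    minimal : ∀ Y → RestrictInit L Y → Y ≢ zeroVec → Y ≤ˢ C → Y ≡ C
    minimal Y (t , LYt) Y≢0 Y≤C with ≡-dec _≟ˢ_ Y C
    ... | yes Y≡C = Y≡C
    ... | no Y≢C  = ⊥-elim (<⇒≱ (zeros-bound (Y ∷ʳ t) LYt (∷ʳ-nonzero Y t Y≢0))
                      (≤-trans (m≤n+m∸n r 1) (≤-trans (s≤s (≤-reflexive (sym ∣ZC∣)))
                        (≤-trans (≤ˢ-strict-zeros {X = C} {Y} Y≤C Y≢C) (zeros-∷ʳ-≥ Y t)))))

  localizationSign : ∀ C {a} → a ≢ zer → IsCocircuit L (C ∷ʳ a) → σ C ≡ a
  localizationSign C {a} a≢0 cCa with σ C ≟ˢ a
  ... | yes σC≡a = σC≡a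
  ... | no σC≢a  = ⊥-elim (noZeroExtension C (proj₁ (proj₂ cC)) (prefix-zeros C a≢0 cCa)
                            (zeroExtension (zero-or-opposite a≢0 σC≢a)))
    where
    cC : IsCocircuit (RestrictInit L) C
    cC = restrictCocircuit C a≢0 cCa
    LCσ : L (C ∷ʳ σ C)
    LCσ = proj₁ (loc C cC)
    zeroExtension : σ C ≡ zer ⊎ σ C ≡ neg a → L (C ∷ʳ zer)
    zeroExtension (inj₁ σC≡0)  = subst (λ s → L (C ∷ʳ s)) σC≡0 LCσ
    zeroExtension (inj₂ σC≡-a) =
      oppositeExtensions C a≢0 (proj₁ cCa) (subst (λ s → L (C ∷ʳ s)) σC≡-a LCσ)

  splitCocircuit : ∀ Y → IsCocircuit L Y → lookup Y new ≢ zer →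
    Σ (SignVec n₀) λ C → IsCocircuit (RestrictInit L) C × Y ≡ C ∷ʳ σ C
  splitCocircuit Y cY Yₙ≢0 with initLast Y
  ... | C , a , refl = C , restrictCocircuit C a≢0 cY , cong (C ∷ʳ_) (sym (localizationSign C a≢0 cY))
    where
    a≢0 : a ≢ zer
    a≢0 a≡0 = Yₙ≢0 (trans (lookup-∷ʳ-last C a) a≡0)

-- Neighborly extensions: the covectors provided by faces

module NeighborlyExtension {n₀ : ℕ} {L : SignVec (suc n₀) → Set} (om : IsOrientedMatroid L)
                  {r : ℕ} (unif : IsUniformOfRank L r) (1≤r : 1 ≤ r) (r≤n₀ : r ≤ n₀)
                  {σ : SignVec n₀ → Sign} (loc : IsLocalization L σ)
                  {k : ℕ} (faces : ∀ F → ∣ F ∣ ≡ k → IsFace L F) (k≤n₀ : k ≤ n₀) where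

  open IsOrientedMatroid om
  open UniformOM om unif 1≤r (m≤n⇒m≤1+n r≤n₀) using (conformalCocircuit)
  open Extension om unif 1≤r r≤n₀ loc using (new; splitCocircuit)

  signedCocircuit : ∀ X → L X → lookup X new ≢ zer → (∀ i → i ≢ new → lookup X i ≢ minus) →
    ∀ S → S ⊑ zeroSet X →
    Σ (SignVec n₀) λ D → IsCocircuit (RestrictInit L) D × NonNeg D × S ⊑ zeroSetExt D × σ D ≡ lookup X new
  signedCocircuit X LX Xₙ≢0 nonneg S S⊑Z with conformalCocircuit X LX new Xₙ≢0
  ... | Y , cY , Y≤X , Yₙ with splitCocircuit Y cY (λ Yₙ≡0 → Xₙ≢0 (trans (sym Yₙ) Yₙ≡0))
  ...   | D , cD , refl = D , cD , nonnegD , (λ i Sᵢ → zeroSet⊑ i (S⊑Z i Sᵢ)) , σD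
    where
    σD : σ D ≡ lookup X new
    σD = trans (sym (lookup-∷ʳ-last D (σ D))) Yₙ
    σD≢0 : σ D ≢ zer
    σD≢0 σD≡0 = Xₙ≢0 (trans (sym σD) σD≡0)
    nonnegD : NonNeg D
    nonnegD i Dᵢ≡- = ≤ˢ-nonneg {X = X} {D ∷ʳ σ D} Y≤X (inject₁ i)
      (nonneg (inject₁ i) (λ eq → fromℕ≢inject₁ (sym eq)))
      (trans (lookup-∷ʳ-inject₁ D (σ D) i) Dᵢ≡-)
    zeroSet⊑ : zeroSet X ⊑ zeroSetExt D
    zeroSet⊑ = subst (zeroSet X ⊑_)
                 (trans (zeroSet-∷ʳ D (σ D)) (cong (zeroSet D ∷ʳ_) (isZero-nonzero σD≢0)))
                     (≤ˢ-zeroSet {X = X} {D ∷ʳ σ D} Y≤X)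

  Covering : Subset (suc n₀) → Set
  Covering I = Σ (SignVec n₀) λ C → IsCocircuit (RestrictInit L) C × NonNeg C ×
                                    I ⊆ zeroSetExt C × σ C ≡ plus

  Crossing : Subset (suc n₀) → ℕ → Sign → Set
  Crossing I m s = Σ (SignVec n₀) λ D → IsCocircuit (RestrictInit L) D × NonNeg D ×
                                        ∣ zeroSetExt D ∩ I ∣ ≡ m ∸ 1 × σ D ≡ s

  -- If the new element is not in I, the face of a k-set K ⊇ I gives a covering cocircuit.
  covering : ∀ I → lookup I new ≡ false → ∣ I ∣ ≤ k → Covering I
  covering I Iₙ ∣I∣≤k with extendAvoiding I new k Iₙ ∣I∣≤k k≤n₀
  ... | K , I⊑K , Kₙ , ∣K∣ with signedCocircuit (faceVector K) (faces K ∣K∣)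
                                 (nonzero-by (faceVector-∌ K new Kₙ) (λ ())) (λ i _ → faceVector-nonneg K i)
                                 I (faceVector-zeros I K I⊑K)
  ...   | C , cC , nnC , I⊑Z , σC = C , cC , nnC , ⊑⇒⊆ I⊑Z , trans σC (faceVector-∌ K new Kₙ)

  remove-new-card : ∀ I m → lookup I new ≡ true → ∣ I ∣ ≡ m → ∣ I [ new ]≔ false ∣ ≡ m ∸ 1
  remove-new-card I m Iₙ ∣I∣ = cong (_∸ 1) (trans (remove-card I new Iₙ) ∣I∣)

  crossing : ∀ I m → lookup I new ≡ true → ∣ I ∣ ≡ m →
    ∀ X → L X → lookup X new ≢ zer → (∀ i → i ≢ new → lookup X i ≢ minus) →
    I [ new ]≔ false ⊑ zeroSet X → Crossing I m (lookup X new)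
  crossing I m Iₙ ∣I∣ X LX Xₙ≢0 nonneg J⊑Z
    with signedCocircuit X LX Xₙ≢0 nonneg (I [ new ]≔ false) J⊑Z
  ... | D , cD , nnD , J⊑ZD , σD = D , cD , nnD , ∣Z∩I∣ , σD
    where
    ∣Z∩I∣ : ∣ zeroSetExt D ∩ I ∣ ≡ m ∸ 1
    ∣Z∩I∣ = trans (cong ∣_∣ (∩-remove (zeroSetExt D) I new (lookup-∷ʳ-last (zeroSet D) false) J⊑ZD))
                  (remove-new-card I m Iₙ ∣I∣)

  -- With J = I − new ⊆ K' ⊆ K, |K'| = k − 1, |K| = k and new ∉ K, the covectors
  -- face(K) and face(K' + new) ∘ (−face(K)) give crossing cocircuits of both signs.
  crossings : ∀ I m → lookup I new ≡ true → ∣ I ∣ ≡ m → 1 ≤ k → m ≤ k →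
    Crossing I m plus × Crossing I m minus
  crossings I m Iₙ ∣I∣ 1≤k m≤k
    with extendAvoiding (I [ new ]≔ false) new (k ∸ 1) (lookup∘update new I false)
           (≤-trans (≤-reflexive (remove-new-card I m Iₙ ∣I∣)) (∸-monoˡ-≤ 1 m≤k))
           (≤-trans (m∸n≤m k 1) k≤n₀)
  ... | K' , J⊑K' , K'ₙ , ∣K'∣
    with extendAvoiding K' new k K'ₙ (≤-trans (≤-reflexive ∣K'∣) (m∸n≤m k 1)) k≤n₀
  ...   | K , K'⊑K , Kₙ , ∣K∣ =
    subst (Crossing I m) (faceVector-∌ K new Kₙ)
      (crossing I m Iₙ ∣I∣ (faceVector K) (faces K ∣K∣) (nonzero-by (faceVector-∌ K new Kₙ) (λ ()))
        (λ i _ → faceVector-nonneg K i) (faceVector-zeros J K (λ i Jᵢ → K'⊑K i (J⊑K' i Jᵢ)))) ,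
    subst (Crossing I m) (flipVector-at K' K new Kₙ)
      (crossing I m Iₙ ∣I∣ (flipVector K' K new)
        (cov-comp _ _ (faces (K' [ new ]≔ true) ∣K'+new∣) (cov-neg _ (faces K ∣K∣)))
        (nonzero-by (flipVector-at K' K new Kₙ) (λ ())) (flipVector-nonneg K' K new K'⊑K)
        (flipVector-zeros J K' K new J⊑K' K'⊑K))
    where
    J : Subset (suc n₀)
    J = I [ new ]≔ false
    ∣K'+new∣ : ∣ K' [ new ]≔ true ∣ ≡ k
    ∣K'+new∣ = trans (insert-card K' new K'ₙ) (trans (cong suc ∣K'∣) (m+[n∸m]≡n 1≤k))

  dichotomy : ∀ I m → ∣ I ∣ ≡ m → 1 ≤ k → m ≤ k →
    Covering I ⊎ (Crossing I m plus × Crossing I m minus)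
  dichotomy I m ∣I∣ 1≤k m≤k with lookup I new in Iₙ
  ... | false = inj₁ (covering I Iₙ (≤-trans (≤-reflexive ∣I∣) m≤k))
  ... | true  = inj₂ (crossings I m Iₙ ∣I∣ 1≤k m≤k)

-- The theorem.  The bound k ≤ ⌊(r−1)/2⌋ is only needed to fit a k-set into [n−1].

mainTheorem1 : (r n₀ k : ℕ) → 1 ≤ r → 1 ≤ k → r + 2 ≤ suc n₀ → k ≤ (r ∸ 1) / 2 →
    (Mhat : SignVec (suc n₀) → Set) → IsOrientedMatroid Mhat →
    IsUniformOfRank Mhat r → Neighborly k Mhat →
    (σ : SignVec n₀ → Sign) → IsLocalization Mhat σ →
    (m : ℕ) → 1 ≤ m → m ≤ k →
    (I : Subset (suc n₀)) → ∣ I ∣ ≡ m →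
    (Σ (SignVec n₀) λ C → IsCocircuit (RestrictInit Mhat) C × NonNeg C ×
        I ⊆ zeroSetExt C × σ C ≡ plus)
    ⊎ ((Σ (SignVec n₀) λ D → IsCocircuit (RestrictInit Mhat) D × NonNeg D ×
          ∣ zeroSetExt D ∩ I ∣ ≡ m ∸ 1 × σ D ≡ plus)
       × (Σ (SignVec n₀) λ D → IsCocircuit (RestrictInit Mhat) D × NonNeg D ×
          ∣ zeroSetExt D ∩ I ∣ ≡ m ∸ 1 × σ D ≡ minus))
mainTheorem1 r n₀ k 1≤r 1≤k r+2≤n k≤⌊r-1⌋/2 Mhat om unif (_ , faces) σ loc m _ m≤k I ∣I∣ =
  dichotomy I m ∣I∣ 1≤k m≤k
  where
  r≤n₀ : r ≤ n₀
  r≤n₀ = ≤-pred (≤-trans (≤-reflexive (+-comm 1 r)) (≤-trans (+-monoʳ-≤ r (s≤s z≤n)) r+2≤n))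
  k≤n₀ : k ≤ n₀
  k≤n₀ = ≤-trans k≤⌊r-1⌋/2 (≤-trans (m/n≤m (r ∸ 1) 2) (≤-trans (m∸n≤m r 1) r≤n₀))
  open NeighborlyExtension om unif 1≤r r≤n₀ loc faces k≤n₀
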